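{- Let $q\ge 4$ be a prime power and $V=\mathbb{F}_q^{\,q+1}$. Let $P=\langle x_1,\dots,x_{q+1}\rangle$ be a simplex point with $x_i=0$. Define $a_j=x_j^{ -1}$ for $j\ne i$ and $a_i=0$. If a simplex point $Q=\langle y_1,\dots,y_{q+1}\rangle$ is adjacent to $P$, then $$a_1y_1+\dots+a_{q+1}y_{q+1}=0.$$ Moreover, in the case $q=4$, a simplex point $Q=\langle y_1,\dots,y_{q+1}\rangle$ is adjacent to $P$ if and only if it satisfies this equation and $y_i\ne 0$.
   Context: A vector of $V=\mathbb{F}_q^{\,q+1}$ is a simplex vector if precisely one of its coordinates is zero. For a non-zero vector $(a_1,\dots,a_n)$, $\langle a_1,\dots,a_n\rangle$ denotes the $1$-dimensional subspace it spans. A point is a $1$-dimensional subspace, a line a $2$-dimensional subspace. A simplex point is a point spanned by a simplex vector; a simplex line is a line all of whose non-zero vectors are simplex vectors. Two distinct simplex points are adjacent if the line containing them is a simplex line. -}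

module Defs where

open import Level using (0ℓ)
open import Data.Nat using (ℕ; zero; suc)
open import Data.Fin using (Fin; zero; suc; _≟_)
open import Data.Product using (Σ; ∃; _×_; _,_)
open import Data.Bool using (if_then_else_)
open import Relation.Nullary using (¬_; does)
open import Relation.Binary.PropositionalEquality using (_≡_; _≢_)
open import Algebra.Structures using (IsCommutativeRing)
open import Function.Bundles using (_↔_)

-- Every such field has prime-power order, and for each prime power q it is
-- unique up to isomorphism, so this is "F_q".
record FiniteField (q : ℕ) : Set₁ where
  infixl 7 _*_
  infixl 6 _+_
  field
    Carrier : Set
    _+_ _*_ : Carrier → Carrier → Carrier
    -_ : Carrier → Carrier
    0# 1# : Carrier
    isCommutativeRing : IsCommutativeRing _≡_ _+_ _*_ -_ 0# 1#
    _⁻¹ : Carrier → Carrier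
    0≢1 : 0# ≢ 1#
    inverseʳ : ∀ x → x ≢ 0# → x * (x ⁻¹) ≡ 1#
    card : Carrier ↔ Fin q

module _ {q : ℕ} (F : FiniteField q) where
  open FiniteField F

  Vect : Set
  Vect = Fin (suc q) → Carrier

  Σ[_] : ∀ {n} → (Fin n → Carrier) → Carrier
  Σ[_] {zero} f = 0#
  Σ[_] {suc n} f = f zero + Σ[_] (λ j → f (suc j))

  NonZero : Vect → Set
  NonZero v = ¬ (∀ j → v j ≡ 0#)

  SimplexVector : Vect → Set
  SimplexVector v = ∃ λ i → (v i ≡ 0#) × (∀ j → v j ≡ 0# → j ≡ i)

  -- the points ⟨x⟩ and ⟨y⟩ (x, y non-zero) are equal iff y = c x for some c
  SamePoint : Vect → Vect → Set
  SamePoint x y = ∃ λ c → ∀ j → y j ≡ c * x j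

  SimplexLine : Vect → Vect → Set
  SimplexLine x y = ∀ α β → NonZero (λ j → α * x j + β * y j)
                          → SimplexVector (λ j → α * x j + β * y j)

  Adjacent : Vect → Vect → Set
  Adjacent x y = ¬ SamePoint x y × SimplexLine x y

  coeff : Vect → Fin (suc q) → Vect
  coeff x i j = if does (j ≟ i) then 0# else (x j) ⁻¹

-- Write ⟨x⟩ for the fixed simplex point, x i = 0, and r_j = y_j / x_j (j ≠ i) for the
-- ratios of a second point ⟨y⟩, so that the equation of the theorem reads Σ_j r_j = 0.
-- A vector αx + βy with β ≠ 0 vanishes exactly at the coordinates j ≠ i with r_j = -α/β
-- (and at i only if y_i = 0). Hence ⟨x⟩ and ⟨y⟩ are adjacent iff y_i ≠ 0 and the q
-- ratios are pairwise distinct, i.e. iff they run through all of F_q. The elements of F_q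
-- sum to 0 once q ≥ 3, which gives the equation. For q = 4 the converse holds because
-- F_4 has characteristic 2: one ratio is 0 (where y vanishes), and three nonzero elements
-- with sum 0 cannot contain a repetition, since a + a + c = 0 would force c = 0.
module Submission where

open import Defs
open import Data.Bool using (if_then_else_)
open import Data.Nat using (ℕ; zero; suc; _≤_)
open import Data.Nat.Properties using (n<1+n; ≤-trans; n≤1+n)
open import Data.Fin as Fin using (Fin; zero; suc; punchIn; punchOut; inject≤)
open import Data.Fin.Properties
  using (any?; inj⇒≟; <⇒notInjective; inject≤-injective;
         punchIn-injective; punchInᵢ≢i; punchIn-punchOut; punchOut-injective)
open import Data.Fin.Patterns using (0F; 1F; 2F)
open import Data.Fin.Permutation using (Permutation; permutation)
open import Data.Product using (∃; _×_; _,_; proj₁; proj₂)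
open import Data.Empty using (⊥-elim)
open import Data.Vec.Functional using (removeAt; replicate)
open import Function using (_∘_)
open import Function.Bundles using (Inverse; Injection; Equivalence; _⇔_; mk⇔)
open import Function.Definitions using (Injective)
open import Function.Properties.Inverse using (↔⇒↣; ↔-sym)
open import Level using (0ℓ)
open import Relation.Binary.Definitions using (DecidableEquality)
open import Relation.Nullary using (yes; no; contradiction)
open import Relation.Nullary.Decidable using (dec-true; dec-false)
open import Relation.Binary.PropositionalEquality
open import Algebra.Bundles using (CommutativeRing)
open import Algebra.Structures using (IsCommutativeRing)

open Equivalence using (to; from)

injective⇒surjective : ∀ {n} {f : Fin n → Fin n} → Injective _≡_ _≡_ f
  → ∀ t → ∃ λ a → f a ≡ t
injective⇒surjective {zero} _ ()
injective⇒surjective {suc n} {f} f-injective t with any? (λ a → f a Fin.≟ t)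
... | yes hit = hit
... | no miss = ⊥-elim (<⇒notInjective (n<1+n n) avoid-injective)
  where
  t≢f : ∀ a → t ≢ f a
  t≢f a t≡fa = miss (a , sym t≡fa)
  avoid : Fin (suc n) → Fin n
  avoid a = punchOut (t≢f a)
  avoid-injective : Injective _≡_ _≡_ avoid
  avoid-injective eq = f-injective (punchOut-injective (t≢f _) (t≢f _) eq)

injective⇒permutation : ∀ {n} {f : Fin n → Fin n} → Injective _≡_ _≡_ f → Permutation n n
injective⇒permutation {f = f} f-injective = permutation f
  (λ t → proj₁ (injective⇒surjective f-injective t))
  (λ t → proj₂ (injective⇒surjective f-injective t))
  (λ a → f-injective (proj₂ (injective⇒surjective f-injective (f a))))

injective-off-point : ∀ {n} {A : Set} (f : Fin (suc n) → A) (z : Fin (suc n))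
  → (∀ a → f a ≡ f z → a ≡ z) → Injective _≡_ _≡_ (f ∘ punchIn z) → Injective _≡_ _≡_ f
injective-off-point f z only-z f∘punchIn-injective {a} {b} fa≡fb
  with a Fin.≟ z | b Fin.≟ z
... | yes refl | _ = sym (only-z b (sym fa≡fb))
... | no _ | yes refl = only-z a fa≡fb
... | no a≢z | no b≢z = begin
  a                         ≡⟨ punchIn-punchOut z≢a ⟨
  punchIn z (punchOut z≢a)  ≡⟨ cong (punchIn z) (f∘punchIn-injective (begin
      f (punchIn z (punchOut z≢a))  ≡⟨ cong f (punchIn-punchOut z≢a) ⟩
      f a                           ≡⟨ fa≡fb ⟩
      f b                           ≡⟨ cong f (punchIn-punchOut z≢b) ⟨
      f (punchIn z (punchOut z≢b))  ∎)) ⟩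
  punchIn z (punchOut z≢b)  ≡⟨ punchIn-punchOut z≢b ⟩
  b                         ∎
  where
  open ≡-Reasoning
  z≢a : z ≢ a
  z≢a = a≢z ∘ sym
  z≢b : z ≢ b
  z≢b = b≢z ∘ sym

module FiniteFieldProperties {q : ℕ} (F : FiniteField q) where

  open FiniteField F
  open ≡-Reasoning

  commutativeRing : CommutativeRing 0ℓ 0ℓ
  commutativeRing = record { isCommutativeRing = isCommutativeRing }

  open CommutativeRing commutativeRing using (ring; semiring; +-commutativeMonoid; _-_)
  open IsCommutativeRing isCommutativeRing
    using (-‿inverseʳ; *-assoc; *-comm; *-identityˡ; zeroʳ)
  open import Algebra.Properties.Ring ring
    using (-‿distribˡ-*; +-inverseʳ-unique; +-cancelʳ; +-identityʳ-unique;
           x∙y⁻¹≈ε⇒x≈y; [y-z]x≈yx-zx)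
  open import Algebra.Properties.Semiring.Mult semiring using () renaming (_×_ to _×ₙ_)
  open import Algebra.Properties.Semiring.Sum semiring using (*-distribˡ-sum)
  open import Algebra.Properties.CommutativeMonoid.Sum +-commutativeMonoid
    using (sum-permute; sum-replicate; ∑-distrib-+)
  open import Algebra.Properties.CommutativeMonoid.Sum +-commutativeMonoid
    using (sum; sum-cong-≗; sum-remove) public

  _≟_ : DecidableEquality Carrier
  _≟_ = inj⇒≟ (↔⇒↣ card)

  element : Fin q → Carrier
  element = Inverse.from card

  index : Carrier → Fin q
  index = Inverse.to card

  element-index : ∀ x → element (index x) ≡ x
  element-index = Inverse.strictlyInverseʳ card

  index-injective : Injective _≡_ _≡_ index
  index-injective = Injection.injective (↔⇒↣ card)

  element-injective : Injective _≡_ _≡_ element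
  element-injective = Injection.injective (↔⇒↣ (↔-sym card))

  1≢0 : 1# ≢ 0#
  1≢0 = 0≢1 ∘ sym

  ⁻¹-inverseˡ : ∀ {x} → x ≢ 0# → x ⁻¹ * x ≡ 1#
  ⁻¹-inverseˡ {x} x≢0 = trans (*-comm (x ⁻¹) x) (inverseʳ x x≢0)

  x⁻¹≢0 : ∀ {x} → x ≢ 0# → x ⁻¹ ≢ 0#
  x⁻¹≢0 {x} x≢0 x⁻¹≡0 = 0≢1 (begin
    0#        ≡⟨ zeroʳ x ⟨
    x * 0#    ≡⟨ cong (x *_) x⁻¹≡0 ⟨
    x * x ⁻¹  ≡⟨ inverseʳ x x≢0 ⟩
    1#        ∎)

  ⁻¹-cancelˡ : ∀ {x} y → x ≢ 0# → x ⁻¹ * (x * y) ≡ y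
  ⁻¹-cancelˡ {x} y x≢0 = begin
    x ⁻¹ * (x * y)  ≡⟨ *-assoc (x ⁻¹) x y ⟨
    x ⁻¹ * x * y    ≡⟨ cong (_* y) (⁻¹-inverseˡ x≢0) ⟩
    1# * y          ≡⟨ *-identityˡ y ⟩
    y               ∎

  *-cancelˡ : ∀ {x y z} → x ≢ 0# → x * y ≡ x * z → y ≡ z
  *-cancelˡ {x} {y} {z} x≢0 xy≡xz = begin
    y               ≡⟨ ⁻¹-cancelˡ y x≢0 ⟨
    x ⁻¹ * (x * y)  ≡⟨ cong (x ⁻¹ *_) xy≡xz ⟩
    x ⁻¹ * (x * z)  ≡⟨ ⁻¹-cancelˡ z x≢0 ⟩
    z               ∎

  x*y≡0⇒y≡0 : ∀ {x y} → x ≢ 0# → x * y ≡ 0# → y ≡ 0#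
  x*y≡0⇒y≡0 {x} x≢0 xy≡0 = *-cancelˡ x≢0 (trans xy≡0 (sym (zeroʳ x)))

  x*x≡0⇒x≡0 : ∀ {x} → x * x ≡ 0# → x ≡ 0#
  x*x≡0⇒x≡0 {x} xx≡0 with x ≟ 0#
  ... | yes x≡0 = x≡0
  ... | no x≢0 = x*y≡0⇒y≡0 x≢0 xx≡0

  α*x+β*y≡0⇔y≡t*x : ∀ {α β t} x y → β ≢ 0# → t * β ≡ - α
    → (α * x + β * y ≡ 0#) ⇔ (y ≡ t * x)
  α*x+β*y≡0⇔y≡t*x {α} {β} {t} x y β≢0 tβ≡-α = mk⇔
    (λ αx+βy≡0 → *-cancelˡ β≢0
      (trans (+-inverseʳ-unique (α * x) (β * y) αx+βy≡0) (sym β[tx]≡-αx)))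
    (λ y≡tx → begin
      α * x + β * y        ≡⟨ cong (λ z → α * x + β * z) y≡tx ⟩
      α * x + β * (t * x)  ≡⟨ cong (α * x +_) β[tx]≡-αx ⟩
      α * x - α * x        ≡⟨ -‿inverseʳ (α * x) ⟩
      0#                   ∎)
    where
    β[tx]≡-αx : β * (t * x) ≡ - (α * x)
    β[tx]≡-αx = begin
      β * (t * x)  ≡⟨ *-assoc β t x ⟨
      β * t * x    ≡⟨ cong (_* x) (trans (*-comm β t) tβ≡-α) ⟩
      - α * x      ≡⟨ -‿distribˡ-* α x ⟨
      - (α * x)    ∎

  y≡t*x⇔x⁻¹*y≡t : ∀ {x y t} → x ≢ 0# → (y ≡ t * x) ⇔ (x ⁻¹ * y ≡ t)
  y≡t*x⇔x⁻¹*y≡t {x} {y} {t} x≢0 = mk⇔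
    (λ y≡tx → trans (cong (x ⁻¹ *_) y≡tx) x⁻¹[tx]≡t)
    (λ x⁻¹y≡t → *-cancelˡ (x⁻¹≢0 x≢0) (trans x⁻¹y≡t (sym x⁻¹[tx]≡t)))
    where
    x⁻¹[tx]≡t : x ⁻¹ * (t * x) ≡ t
    x⁻¹[tx]≡t = trans (cong (x ⁻¹ *_) (*-comm t x)) (⁻¹-cancelˡ t x≢0)

  Σ≡sum : ∀ {n} (f : Fin n → Carrier) → Σ[_] F f ≡ sum f
  Σ≡sum {zero} f = refl
  Σ≡sum {suc n} f = cong (f zero +_) (Σ≡sum (f ∘ suc))

  injective⇒surjective′ : ∀ {h : Fin q → Carrier} → Injective _≡_ _≡_ h
    → ∀ x → ∃ λ a → h a ≡ x
  injective⇒surjective′ {h} h-injective x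
    with a , index-ha≡index-x ← injective⇒surjective (h-injective ∘ index-injective) (index x)
    = a , (begin
      h a                    ≡⟨ element-index (h a) ⟨
      element (index (h a))  ≡⟨ cong element index-ha≡index-x ⟩
      element (index x)      ≡⟨ element-index x ⟩
      x                      ∎)

  sum-injective : ∀ {h : Fin q → Carrier} → Injective _≡_ _≡_ h → sum h ≡ sum element
  sum-injective {h} h-injective = begin
    sum h                      ≡⟨ sum-cong-≗ (λ a → element-index (h a)) ⟨
    sum (element ∘ index ∘ h)  ≡⟨ sum-permute element π ⟨
    sum element                ∎
    where
    π : Permutation q q
    π = injective⇒permutation (h-injective ∘ index-injective)

  ∃≢0,≢1 : 3 ≤ q → ∃ λ c → c ≢ 0# × c ≢ 1#
  ∃≢0,≢1 3≤q =
    among-three (e-distinct 0F 1F λ ()) (e-distinct 0F 2F λ ()) (e-distinct 1F 2F λ ())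
    where
    e : Fin 3 → Carrier
    e k = element (inject≤ k 3≤q)
    e-distinct : ∀ k l → k ≢ l → e k ≢ e l
    e-distinct _ _ k≢l = k≢l ∘ inject≤-injective 3≤q 3≤q _ _ ∘ element-injective
    among-three : ∀ {a b c} → a ≢ b → a ≢ c → b ≢ c → ∃ λ d → d ≢ 0# × d ≢ 1#
    among-three {a} {b} {c} a≢b a≢c b≢c with a ≟ 0# | a ≟ 1# | b ≟ 0# | b ≟ 1#
    ... | no a≢0 | no a≢1 | _ | _ = a , a≢0 , a≢1
    ... | _ | _ | no b≢0 | no b≢1 = b , b≢0 , b≢1
    ... | yes refl | _ | yes refl | _ = contradiction refl a≢b
    ... | _ | yes refl | _ | yes refl = contradiction refl a≢b
    ... | yes refl | _ | _ | yes refl = c , a≢c ∘ sym , b≢c ∘ sym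
    ... | _ | yes refl | yes refl | _ = c , b≢c ∘ sym , a≢c ∘ sym

  -- Multiplication by c ≠ 0 permutes F, so c * Σ ≡ Σ; choosing c ≠ 1 forces Σ ≡ 0.
  sum-element≡0 : 3 ≤ q → sum element ≡ 0#
  sum-element≡0 3≤q with c , c≢0 , c≢1 ← ∃≢0,≢1 3≤q = x*y≡0⇒y≡0 c-1≢0 (begin
    (c - 1#) * sum element              ≡⟨ [y-z]x≈yx-zx (sum element) c 1# ⟩
    c * sum element - 1# * sum element  ≡⟨ cong₂ _-_ c*Σ≡Σ (*-identityˡ (sum element)) ⟩
    sum element - sum element           ≡⟨ -‿inverseʳ (sum element) ⟩
    0#                                  ∎)
    where
    c-1≢0 : c - 1# ≢ 0#
    c-1≢0 = c≢1 ∘ x∙y⁻¹≈ε⇒x≈y c 1#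
    c*Σ≡Σ : c * sum element ≡ sum element
    c*Σ≡Σ = trans (*-distribˡ-sum c element) (sum-injective (element-injective ∘ *-cancelˡ c≢0))

  -- Translation by 1 permutes F, so Σ + q·1 ≡ Σ.
  q×1≡0 : q ×ₙ 1# ≡ 0#
  q×1≡0 = +-identityʳ-unique (sum element) (q ×ₙ 1#) (begin
    sum element + q ×ₙ 1#               ≡⟨ cong (sum element +_) (sum-replicate q) ⟨
    sum element + sum (replicate q 1#)  ≡⟨ ∑-distrib-+ element (replicate q 1#) ⟨
    sum (λ a → element a + 1#)          ≡⟨ sum-injective (element-injective ∘ +-cancelʳ 1# _ _) ⟩
    sum element                         ∎)

module OrderFour (F : FiniteField 4) where

  open FiniteField F
  open FiniteFieldProperties F
  open ≡-Reasoning
  open IsCommutativeRing isCommutativeRing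
    using (+-assoc; +-identityˡ; +-identityʳ; *-identityˡ; zeroˡ)
  open import Algebra.Properties.Semiring.Mult (CommutativeRing.semiring commutativeRing)
    using (×-assoc-*; ×1-homo-*) renaming (_×_ to _×ₙ_)

  x+x≡0 : ∀ x → x + x ≡ 0#
  x+x≡0 x = begin
    x + x           ≡⟨ cong (x +_) (+-identityʳ x) ⟨
    2 ×ₙ x          ≡⟨ cong (2 ×ₙ_) (*-identityˡ x) ⟨
    2 ×ₙ (1# * x)   ≡⟨ ×-assoc-* 2 1# x ⟨
    (2 ×ₙ 1#) * x   ≡⟨ cong (_* x) 2×1≡0 ⟩
    0# * x          ≡⟨ zeroˡ x ⟩
    0#              ∎
    where
    2×1≡0 : 2 ×ₙ 1# ≡ 0#
    2×1≡0 = x*x≡0⇒x≡0 (trans (sym (×1-homo-* 2 2)) q×1≡0)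

  -- If r a ≡ r b for a ≠ b and c is the third index, then 0 ≡ r a + r a + r c ≡ r c.
  nonzero-sum≡0⇒injective : (r : Fin 3 → Carrier) → (∀ a → r a ≢ 0#) → sum r ≡ 0#
    → Injective _≡_ _≡_ r
  nonzero-sum≡0⇒injective r r≢0 Σr≡0 {a} {b} ra≡rb with a Fin.≟ b
  ... | yes a≡b = a≡b
  ... | no a≢b = contradiction rc≡0 (r≢0 c)
    where
    b′ : Fin 2
    b′ = punchOut a≢b
    c : Fin 3
    c = punchIn a (punchIn b′ zero)
    rb′≡ra : removeAt r a b′ ≡ r a
    rb′≡ra = trans (cong r (punchIn-punchOut a≢b)) (sym ra≡rb)
    rc≡0 : r c ≡ 0#
    rc≡0 = begin
      r c                                      ≡⟨ +-identityʳ (r c) ⟨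
      r c + 0#                                 ≡⟨ +-identityˡ (r c + 0#) ⟨
      0# + (r c + 0#)                          ≡⟨ cong (_+ (r c + 0#)) (x+x≡0 (r a)) ⟨
      r a + r a + (r c + 0#)                   ≡⟨ +-assoc (r a) (r a) (r c + 0#) ⟩
      r a + (r a + (r c + 0#))                 ≡⟨ cong (λ x → r a + (x + (r c + 0#))) rb′≡ra ⟨
      r a + (removeAt r a b′ + (r c + 0#))     ≡⟨ cong (r a +_) (sum-remove {i = b′} (removeAt r a)) ⟨
      r a + sum (removeAt r a)                 ≡⟨ sum-remove {i = a} r ⟨
      sum r                                    ≡⟨ Σr≡0 ⟩
      0#                                       ∎

  unique-zero-sum≡0⇒injective : (ρ : Fin 4 → Carrier) (z : Fin 4) → ρ z ≡ 0#
    → (∀ a → ρ a ≡ 0# → a ≡ z) → sum ρ ≡ 0# → Injective _≡_ _≡_ ρ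
  unique-zero-sum≡0⇒injective ρ z ρz≡0 only-z Σρ≡0 = injective-off-point ρ z
    (λ a ρa≡ρz → only-z a (trans ρa≡ρz ρz≡0))
    (nonzero-sum≡0⇒injective (removeAt ρ z) (λ a → punchInᵢ≢i z a ∘ only-z (punchIn z a))
      Σ′≡0)
    where
    Σ′≡0 : sum (removeAt ρ z) ≡ 0#
    Σ′≡0 = begin
      sum (removeAt ρ z)        ≡⟨ +-identityˡ (sum (removeAt ρ z)) ⟨
      0# + sum (removeAt ρ z)   ≡⟨ cong (_+ sum (removeAt ρ z)) ρz≡0 ⟨
      ρ z + sum (removeAt ρ z)  ≡⟨ sum-remove {i = z} ρ ⟨
      sum ρ                     ≡⟨ Σρ≡0 ⟩
      0#                        ∎

module SimplexPoint {q : ℕ} (F : FiniteField q) (x : Vect F) (x-simplex : SimplexVector F x)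
                    (i : Fin (suc q)) (xᵢ≡0 : x i ≡ FiniteField.0# F) where

  open FiniteField F
  open FiniteFieldProperties F
  open ≡-Reasoning
  open IsCommutativeRing isCommutativeRing
    using (+-identityˡ; +-identityʳ; *-assoc; *-identityʳ; zeroˡ; zeroʳ)
  open import Algebra.Properties.Ring (CommutativeRing.ring commutativeRing) using (-‿involutive)

  simplex-zero-unique : ∀ {v} → SimplexVector F v → ∀ {j k} → v j ≡ 0# → v k ≡ 0# → j ≡ k
  simplex-zero-unique (_ , _ , only) vⱼ≡0 vₖ≡0 = trans (only _ vⱼ≡0) (sym (only _ vₖ≡0))

  ExactlyOne : (Fin (suc q) → Set) → Set
  ExactlyOne P = ∃ λ j → P j × ∀ m → P m → m ≡ j

  simplex-from-zeros : ∀ {v} {P : Fin (suc q) → Set} → (∀ m → (v m ≡ 0#) ⇔ P m)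
    → ExactlyOne P → SimplexVector F v
  simplex-from-zeros vₘ≡0⇔P (j , Pj , only) =
    j , from (vₘ≡0⇔P j) Pj , λ m → only m ∘ to (vₘ≡0⇔P m)

  x≢0 : ∀ a → x (punchIn i a) ≢ 0#
  x≢0 a = punchInᵢ≢i i a ∘ λ x≡0 → simplex-zero-unique x-simplex x≡0 xᵢ≡0

  ratio : Vect F → Fin q → Carrier
  ratio y a = x (punchIn i a) ⁻¹ * y (punchIn i a)

  y≡t*x⇔ratio≡t : ∀ y {t} a → (y (punchIn i a) ≡ t * x (punchIn i a)) ⇔ (ratio y a ≡ t)
  y≡t*x⇔ratio≡t _ a = y≡t*x⇔x⁻¹*y≡t (x≢0 a)

  yᵢ≡t*xᵢ⇔yᵢ≡0 : ∀ (y : Vect F) t → (y i ≡ t * x i) ⇔ (y i ≡ 0#)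
  yᵢ≡t*xᵢ⇔yᵢ≡0 _ t =
    mk⇔ (λ yᵢ≡txᵢ → trans yᵢ≡txᵢ t*xᵢ≡0) (λ yᵢ≡0 → trans yᵢ≡0 (sym t*xᵢ≡0))
    where
    t*xᵢ≡0 : t * x i ≡ 0#
    t*xᵢ≡0 = trans (cong (t *_) xᵢ≡0) (zeroʳ t)

  Σcoeff≡sum-ratio : ∀ y → Σ[_] F (λ j → coeff F x i j * y j) ≡ sum (ratio y)
  Σcoeff≡sum-ratio y = begin
    Σ[_] F g                    ≡⟨ Σ≡sum g ⟩
    sum g                       ≡⟨ sum-remove {i = i} g ⟩
    g i + sum (removeAt g i)    ≡⟨ cong₂ _+_ gᵢ≡0 (sum-cong-≗ g∘punchIn≗ratio) ⟩
    0# + sum (ratio y)          ≡⟨ +-identityˡ (sum (ratio y)) ⟩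
    sum (ratio y)               ∎
    where
    g : Fin (suc q) → Carrier
    g j = coeff F x i j * y j
    gᵢ≡0 : g i ≡ 0#
    gᵢ≡0 = trans (cong (λ b → (if b then 0# else x i ⁻¹) * y i) (dec-true (i Fin.≟ i) refl))
                 (zeroˡ (y i))
    g∘punchIn≗ratio : ∀ a → g (punchIn i a) ≡ ratio y a
    g∘punchIn≗ratio a = cong (λ b → (if b then 0# else x (punchIn i a) ⁻¹) * y (punchIn i a))
                             (dec-false (punchIn i a Fin.≟ i) (punchInᵢ≢i i a))

  -- Apply the simplex-line condition to y − t x, whose zeros are where y is t times x.
  adjacent⇒proportional-at-most-once : ∀ {y} → Adjacent F x y → ∀ t {j k}
    → y j ≡ t * x j → y k ≡ t * x k → j ≡ k
  adjacent⇒proportional-at-most-once {y} (not-same , line) t yⱼ≡txⱼ yₖ≡txₖ =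
    simplex-zero-unique (line (- t) 1# nonzero) (from (zero⇔ _) yⱼ≡txⱼ) (from (zero⇔ _) yₖ≡txₖ)
    where
    zero⇔ : ∀ m → ((- t) * x m + 1# * y m ≡ 0#) ⇔ (y m ≡ t * x m)
    zero⇔ m = α*x+β*y≡0⇔y≡t*x (x m) (y m) 1≢0 (trans (*-identityʳ t) (sym (-‿involutive t)))
    nonzero : NonZero F (λ m → (- t) * x m + 1# * y m)
    nonzero all-zero = not-same (t , λ m → to (zero⇔ m) (all-zero m))

  adjacent⇒ratio-injective : ∀ {y} → Adjacent F x y → Injective _≡_ _≡_ (ratio y)
  adjacent⇒ratio-injective {y} adj {a} {b} ratioₐ≡ratio_b = punchIn-injective i a b
    (adjacent⇒proportional-at-most-once adj (ratio y b)
      (from (y≡t*x⇔ratio≡t y a) ratioₐ≡ratio_b) (from (y≡t*x⇔ratio≡t y b) refl))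

  adjacent⇒yᵢ≢0 : ∀ {y} → Fin q → Adjacent F x y → y i ≢ 0#
  adjacent⇒yᵢ≢0 {y} a adj yᵢ≡0 = punchInᵢ≢i i a
    (adjacent⇒proportional-at-most-once adj (ratio y a)
      (from (y≡t*x⇔ratio≡t y a) refl) (from (yᵢ≡t*xᵢ⇔yᵢ≡0 y _) yᵢ≡0))

  ratio-injective⇒proportional-exactly-once : ∀ {y} → y i ≢ 0# → Injective _≡_ _≡_ (ratio y)
    → ∀ t → ExactlyOne (λ j → y j ≡ t * x j)
  ratio-injective⇒proportional-exactly-once {y} yᵢ≢0 ratio-injective t
    with a , ratioₐ≡t ← injective⇒surjective′ ratio-injective t =
    punchIn i a , from (y≡t*x⇔ratio≡t y a) ratioₐ≡t , only
    where
    only : ∀ m → y m ≡ t * x m → m ≡ punchIn i a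
    only m yₘ≡txₘ with m Fin.≟ i
    ... | yes refl = contradiction (to (yᵢ≡t*xᵢ⇔yᵢ≡0 y t) yₘ≡txₘ) yᵢ≢0
    ... | no m≢i = begin
      m                         ≡⟨ punchIn-punchOut i≢m ⟨
      punchIn i (punchOut i≢m)  ≡⟨ cong (punchIn i) (ratio-injective (trans ratio≡t (sym ratioₐ≡t))) ⟩
      punchIn i a               ∎
      where
      i≢m : i ≢ m
      i≢m = m≢i ∘ sym
      ratio≡t : ratio y (punchOut i≢m) ≡ t
      ratio≡t = to (y≡t*x⇔ratio≡t y _)
        (subst (λ j → y j ≡ t * x j) (sym (punchIn-punchOut i≢m)) yₘ≡txₘ)

  proportional-exactly-once⇒simplexLine : ∀ {y} → (∀ t → ExactlyOne (λ j → y j ≡ t * x j))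
    → SimplexLine F x y
  proportional-exactly-once⇒simplexLine {y} proportional-once α β nonzero with β ≟ 0#
  ... | no β≢0 = simplex-from-zeros
    (λ m → α*x+β*y≡0⇔y≡t*x (x m) (y m) β≢0 slope)
    (proportional-once (- α * β ⁻¹))
    where
    slope : - α * β ⁻¹ * β ≡ - α
    slope = begin
      - α * β ⁻¹ * β    ≡⟨ *-assoc (- α) (β ⁻¹) β ⟩
      - α * (β ⁻¹ * β)  ≡⟨ cong (- α *_) (⁻¹-inverseˡ β≢0) ⟩
      - α * 1#          ≡⟨ *-identityʳ (- α) ⟩
      - α               ∎
  ... | yes refl with α ≟ 0#
  ...   | yes refl = contradiction zero-vector nonzero
    where
    zero-vector : ∀ m → 0# * x m + 0# * y m ≡ 0#
    zero-vector m = trans (cong₂ _+_ (zeroˡ (x m)) (zeroˡ (y m))) (+-identityʳ 0#)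
  ...   | no α≢0 = simplex-from-zeros zero⇔ x-simplex
    where
    αxₘ+0yₘ≡αxₘ : ∀ m → α * x m + 0# * y m ≡ α * x m
    αxₘ+0yₘ≡αxₘ m = trans (cong (α * x m +_) (zeroˡ (y m))) (+-identityʳ (α * x m))
    zero⇔ : ∀ m → (α * x m + 0# * y m ≡ 0#) ⇔ (x m ≡ 0#)
    zero⇔ m = mk⇔
      (λ v≡0 → x*y≡0⇒y≡0 α≢0 (trans (sym (αxₘ+0yₘ≡αxₘ m)) v≡0))
      (λ xₘ≡0 → trans (αxₘ+0yₘ≡αxₘ m) (trans (cong (α *_) xₘ≡0) (zeroʳ α)))

  ratio-injective⇒adjacent : ∀ {y} → y i ≢ 0# → Injective _≡_ _≡_ (ratio y) → Adjacent F x y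
  ratio-injective⇒adjacent {y} yᵢ≢0 ratio-injective =
    (λ (c , y≡cx) → yᵢ≢0 (to (yᵢ≡t*xᵢ⇔yᵢ≡0 y c) (y≡cx i))) ,
    proportional-exactly-once⇒simplexLine
      (ratio-injective⇒proportional-exactly-once yᵢ≢0 ratio-injective)

  ratio-zero-unique : ∀ {y} → SimplexVector F y → y i ≢ 0#
    → ∃ λ z → ratio y z ≡ 0# × ∀ a → ratio y a ≡ 0# → a ≡ z
  ratio-zero-unique {y} (k , yₖ≡0 , only-k) yᵢ≢0 =
    punchOut i≢k , from (ratio≡0⇔y≡0 _) (trans (cong y (punchIn-punchOut i≢k)) yₖ≡0) ,
    λ a ratioₐ≡0 → punchIn-injective i a _
      (trans (only-k _ (to (ratio≡0⇔y≡0 a) ratioₐ≡0)) (sym (punchIn-punchOut i≢k)))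
    where
    i≢k : i ≢ k
    i≢k i≡k = yᵢ≢0 (trans (cong y i≡k) yₖ≡0)
    ratio≡0⇔y≡0 : ∀ a → (ratio y a ≡ 0#) ⇔ (y (punchIn i a) ≡ 0#)
    ratio≡0⇔y≡0 a = mk⇔
      (λ ratio≡0 → trans (from (y≡t*x⇔ratio≡t y a) ratio≡0) (zeroˡ _))
      (λ y≡0 → to (y≡t*x⇔ratio≡t y a) (trans y≡0 (sym (zeroˡ _))))

proposition2 : (q : ℕ) → 4 ≤ q → (F : FiniteField q)
    → (x : Vect F) → SimplexVector F x → (i : Fin (suc q)) → x i ≡ FiniteField.0# F
    → ((y : Vect F) → SimplexVector F y → Adjacent F x y
         → Σ[_] F (λ j → FiniteField._*_ F (coeff F x i j) (y j)) ≡ FiniteField.0# F)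
      × (q ≡ 4 → (y : Vect F) → SimplexVector F y
         → Adjacent F x y ⇔ ((Σ[_] F (λ j → FiniteField._*_ F (coeff F x i j) (y j)) ≡ FiniteField.0# F) × (y i ≢ FiniteField.0# F)))
proposition2 q 4≤q F x x-simplex i xᵢ≡0 = equation , adjacent⇔equation
  where
  open FiniteField F using (0#; _*_)
  open FiniteFieldProperties F
  open SimplexPoint F x x-simplex i xᵢ≡0
  open ≡-Reasoning

  equation : (y : Vect F) → SimplexVector F y → Adjacent F x y
    → Σ[_] F (λ j → coeff F x i j * y j) ≡ 0#
  equation y _ adj = begin
    Σ[_] F (λ j → coeff F x i j * y j)  ≡⟨ Σcoeff≡sum-ratio y ⟩
    sum (ratio y)                       ≡⟨ sum-injective (adjacent⇒ratio-injective adj) ⟩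
    sum element                         ≡⟨ sum-element≡0 (≤-trans (n≤1+n 3) 4≤q) ⟩
    0#                                  ∎

  adjacent⇔equation : q ≡ 4 → (y : Vect F) → SimplexVector F y
    → Adjacent F x y ⇔ ((Σ[_] F (λ j → coeff F x i j * y j) ≡ 0#) × (y i ≢ 0#))
  adjacent⇔equation refl y y-simplex = mk⇔
    (λ adj → equation y y-simplex adj , adjacent⇒yᵢ≢0 zero adj)
    (λ (Σ≡0 , yᵢ≢0) → ratio-injective⇒adjacent yᵢ≢0 (ratio-injective Σ≡0 yᵢ≢0))
    where
    ratio-injective : Σ[_] F (λ j → coeff F x i j * y j) ≡ 0# → y i ≢ 0#
      → Injective _≡_ _≡_ (ratio y)
    ratio-injective Σ≡0 yᵢ≢0 with z , ratio-z≡0 , only-z ← ratio-zero-unique y-simplex yᵢ≢0 =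
      OrderFour.unique-zero-sum≡0⇒injective F (ratio y) z ratio-z≡0 only-z
        (trans (sym (Σcoeff≡sum-ratio y)) Σ≡0)
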